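{- Let $p$ be a program of $\mathcal{W}$ and let $\langle r_1,\sigma_1\rangle$ and $\langle r_2,\sigma_2\rangle$ be configurations occurring at two different steps of an execution of $p$. Then $r_1\neq r_2$.
   Context: Programs of $\mathcal W$ consist of statements $\texttt{skip}$, assignments $\mathtt{v:=e}$, conditionals $\texttt{if}(c)\{q_1\}\texttt{else}\{q_2\}$ and loops $\texttt{while}(c)\{q_1\}$, composed sequentially and arbitrarily nested. A state $\sigma$ assigns integer values to program variables (and array entries). A configuration is a pair $\langle q,\sigma\rangle$ of a continuation $q$ (a sequence of statements ending with the marker $end$) and a state; in continuations each while-statement carries a counter $i\in\mathbb N$, written $\texttt{while}^i$. One-step transitions: $\langle\texttt{skip};q,\sigma\rangle\to\langle q,\sigma\rangle$; $\langle\mathtt{v:=e};q,\sigma\rangle\to\langle q,\sigma[\mathtt v\mapsto[\![\mathtt e]\!](\sigma)]\rangle$; $\langle\texttt{if}(c)\{q_1\}\texttt{else}\{q_2\};q,\sigma\rangle\to\langle q_1;q,\sigma\rangle$ if $[\![c]\!](\sigma)$ is true, else $\to\langle q_2;q,\sigma\rangle$; $\langle\texttt{while}^i(c)\{q_1\};q,\sigma\rangle\to\langle q_1;\texttt{while}^{i+1}(c)\{q_1\};q,\sigma\rangle$ if $[\![c]\!](\sigma)$ is true, else $\to\langle q,\sigma\rangle$. An initial configuration is $\langle p',\sigma\rangle$ where $p'$ is $p$ with every while-loop annotated with counter $0$ and $\sigma$ is any state. An execution of $p$ is a sequence of such transitions from an initial configuration to a configuration $\langle end,\sigma\rangle$.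 -}

module Defs where

open import Data.Nat using (ℕ; zero; suc)
open import Data.Fin using (Fin; inject₁) renaming (suc to fsuc)
open import Data.Bool using (Bool; true; false)
open import Data.List using (List; []; _∷_; _++_)
open import Data.Product using (_×_; _,_; Σ; proj₁)
open import Relation.Binary.PropositionalEquality using (_≡_)

-- The expression/state layer of W is kept abstract: a state space,
-- left-hand sides (variables or array entries), expressions and
-- conditions, with the semantics of assignment and of conditions.
record Lang : Set₁ where
  field
    State  : Set
    LVal   : Set
    Expr   : Set
    Cond   : Set
    assign : LVal → Expr → State → State
    test   : Cond → State → Bool

module _ (L : Lang) where
  open Lang L

  data Stmt : Set where
    skip   : Stmt
    _:=_   : LVal → Expr → Stmt
    if_then_else_ : Cond → List Stmt → List Stmt → Stmt
    while_loop_ : Cond → List Stmt → Stmt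

  Prog : Set
  Prog = List Stmt

  data AStmt : Set where
    skip   : AStmt
    _:=_   : LVal → Expr → AStmt
    if_then_else_ : Cond → List AStmt → List AStmt → AStmt
    while[_]_loop_ : ℕ → Cond → List AStmt → AStmt

  -- A continuation is a sequence of annotated statements; the empty list
  -- plays the role of the final marker `end`.
  Cont : Set
  Cont = List AStmt

  Config : Set
  Config = Cont × State

  annotate : Prog → Cont
  annotateS : Stmt → AStmt
  annotate [] = []
  annotate (s ∷ ss) = annotateS s ∷ annotate ss
  annotateS skip = skip
  annotateS (v := e) = v := e
  annotateS (if c then q₁ else q₂) = if c then annotate q₁ else annotate q₂
  annotateS (while c loop q) = while[ 0 ] c loop annotate q

  data _⟶_ : Config → Config → Set where
    step-skip  : ∀ {q σ} → (skip ∷ q , σ) ⟶ (q , σ)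
    step-assign : ∀ {v e q σ} → ((v := e) ∷ q , σ) ⟶ (q , assign v e σ)
    step-if-true : ∀ {c q₁ q₂ q σ} → test c σ ≡ true →
      ((if c then q₁ else q₂) ∷ q , σ) ⟶ (q₁ ++ q , σ)
    step-if-false : ∀ {c q₁ q₂ q σ} → test c σ ≡ false →
      ((if c then q₁ else q₂) ∷ q , σ) ⟶ (q₂ ++ q , σ)
    step-while-true : ∀ {i c q₁ q σ} → test c σ ≡ true →
      ((while[ i ] c loop q₁) ∷ q , σ) ⟶ (q₁ ++ ((while[ suc i ] c loop q₁) ∷ q) , σ)
    step-while-false : ∀ {i c q₁ q σ} → test c σ ≡ false →
      ((while[ i ] c loop q₁) ∷ q , σ) ⟶ (q , σ)

  record Execution (p : Prog) (n : ℕ) : Set where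
    field
      conf    : Fin (suc n) → Config
      initial : Σ State (λ σ → conf Data.Fin.zero ≡ (annotate p , σ))
      steps   : (k : Fin n) → conf (inject₁ k) ⟶ conf (fsuc k)
      final   : Σ State (λ σ → conf (Data.Fin.fromℕ n) ≡ ([] , σ))

-- A transition makes the continuation strictly smaller in a fixed strict order,
-- so the continuations along an execution strictly decrease and are pairwise
-- distinct. Statements are ordered by size, ties broken by a LARGER loop counter:
-- unrolling while^i (c) {q₁} yields the body, which is smaller, and
-- while^(i+1) (c) {q₁}, which has the same size. A step only rewrites the front of a
-- continuation, replacing its head by smaller statements, so continuations are
-- compared lexicographically from their end.
module Submission where

open import Defs
open import Data.Nat using (ℕ; suc)
open import Data.Fin using (Fin)
open import Data.Product using (proj₁)
open import Relation.Binary.PropositionalEquality using (_≢_)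

open import Level using (Level)
open import Function using (_∘_)
open import Data.Nat using (_+_; _≤_; s≤s; z<s)
open import Data.Nat.Properties using (≤-trans; m≤m+n; m≤n+m; n<1+n; <-strictPartialOrder)
open import Data.Fin as Fin using (inject₁) renaming (zero to fzero; suc to fsuc)
import Data.Fin.Properties as Fin
open import Data.List using (List; []; _∷_; _++_; reverse; [_]; _∷ʳ_)
open import Data.List.Properties using (reverse-++; unfold-reverse; ++-assoc)
open import Data.List.Relation.Unary.All as All using (All; []; _∷_)
open import Data.List.Relation.Unary.All.Properties using (∷ʳ⁺)
open import Data.List.Relation.Binary.Lex.Strict using (Lex-<; halt; this; next)
  renaming (<-strictPartialOrder to Lex-<-strictPartialOrder)
open import Data.Product using (_,_)
open import Data.Product.Relation.Binary.Lex.Strict using (×-strictPartialOrder)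
open import Data.Sum using (inj₁; inj₂)
open import Relation.Binary using (Rel; Reflexive; StrictPartialOrder; tri<; tri≈; tri>)
import Relation.Binary.Construct.On as On
import Relation.Binary.Construct.Flip.Ord as Flip
open import Relation.Binary.PropositionalEquality using (_≡_; refl; subst; subst₂; sym)
open import Relation.Nullary using (contradiction)

private
  variable
    a ℓ₁ ℓ₂ : Level
    A : Set a

All-reverse⁺ : {P : A → Set ℓ₁} {xs : List A} → All P xs → All P (reverse xs)
All-reverse⁺ {xs = []}     []         = []
All-reverse⁺ {xs = x ∷ xs} (px ∷ pxs) =
  subst (All _) (sym (unfold-reverse x xs)) (∷ʳ⁺ (All-reverse⁺ pxs) px)

module _ {_≈_ : Rel A ℓ₁} {_≺_ : Rel A ℓ₂} where

  Lex-<-++ˡ : Reflexive _≈_ → ∀ zs {xs ys} →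
              Lex-< _≈_ _≺_ xs ys → Lex-< _≈_ _≺_ (zs ++ xs) (zs ++ ys)
  Lex-<-++ˡ ≈-refl []       xs<ys = xs<ys
  Lex-<-++ˡ ≈-refl (z ∷ zs) xs<ys = next ≈-refl (Lex-<-++ˡ ≈-refl zs xs<ys)

  Lex-<-[_] : ∀ y {xs} → All (_≺ y) xs → Lex-< _≈_ _≺_ xs [ y ]
  Lex-<-[ y ] []        = halt
  Lex-<-[ y ] (x≺y ∷ _) = this x≺y

module _ (S : StrictPartialOrder a ℓ₁ ℓ₂) where
  open StrictPartialOrder S

  StrictlyDecreasing : ∀ {n} → (Fin (suc n) → Carrier) → Set ℓ₂
  StrictlyDecreasing {n} f = (k : Fin n) → f (fsuc k) < f (inject₁ k)

  decreasing⇒antitone : ∀ {n} {f : Fin (suc n) → Carrier} → StrictlyDecreasing f →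
                        ∀ {j k} → j Fin.< k → f k < f j
  decreasing⇒antitone {suc n}     dec {fzero}  {fsuc fzero}    _         = dec fzero
  decreasing⇒antitone {suc n} {f} dec {fzero}  {fsuc (fsuc k)} _         =
    trans (decreasing⇒antitone {f = f ∘ fsuc} (dec ∘ fsuc) {fzero} {fsuc k} z<s) (dec fzero)
  decreasing⇒antitone {suc n} {f} dec {fsuc j} {fsuc k}        (s≤s j<k) =
    decreasing⇒antitone {f = f ∘ fsuc} (dec ∘ fsuc) j<k

  decreasing⇒injective : ∀ {n} {f : Fin (suc n) → Carrier} → StrictlyDecreasing f →
                         ∀ {j k} → f j ≈ f k → j ≡ k
  decreasing⇒injective dec {j} {k} fj≈fk with Fin.<-cmp j k
  ... | tri< j<k _ _ = contradiction (decreasing⇒antitone dec j<k) (irrefl (Eq.sym fj≈fk))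
  ... | tri≈ _ j≡k _ = j≡k
  ... | tri> _ _ k<j = contradiction (decreasing⇒antitone dec k<j) (irrefl fj≈fk)

module _ (L : Lang) where
  open Lang L

  size  : AStmt L → ℕ
  sizes : Cont L → ℕ
  size skip                   = 1
  size (_ := _)               = 1
  size (if _ then q₁ else q₂) = suc (sizes q₁ + sizes q₂)
  size (while[ _ ] _ loop q)  = suc (sizes q)
  sizes []       = 0
  sizes (s ∷ q)  = size s + sizes q

  counter : AStmt L → ℕ
  counter (while[ i ] _ loop _) = i
  counter _                     = 0

  size-≤-sizes : ∀ q → All (λ s → size s ≤ sizes q) q
  size-≤-sizes []      = []
  size-≤-sizes (s ∷ q) = m≤m+n (size s) (sizes q)
                       ∷ All.map (λ p → ≤-trans p (m≤n+m (sizes q) (size s))) (size-≤-sizes q)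

  stmtOrder : StrictPartialOrder _ _ _
  stmtOrder = On.strictPartialOrder
    (×-strictPartialOrder <-strictPartialOrder (Flip.strictPartialOrder <-strictPartialOrder))
    (λ s → size s , counter s)

  contOrder : StrictPartialOrder _ _ _
  contOrder = On.strictPartialOrder (Lex-<-strictPartialOrder stmtOrder) reverse

  open StrictPartialOrder stmtOrder using () renaming (_<_ to _≺_)
  open StrictPartialOrder contOrder using () renaming (_<_ to _⊏_)

  replace-head-⊏ : ∀ s q₁ q → All (_≺ s) q₁ → (q₁ ++ q) ⊏ (s ∷ q)
  replace-head-⊏ s q₁ q q₁≺s = subst₂ (Lex-< _ _) (sym (reverse-++ q₁ q)) (sym (unfold-reverse s q))
    (Lex-<-++ˡ (refl , refl) (reverse q) (Lex-<-[ s ] (All-reverse⁺ q₁≺s)))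

  sizes-<⇒≺ : ∀ s q → sizes q Data.Nat.< size s → All (_≺ s) q
  sizes-<⇒≺ s q q<s = All.map (λ p → inj₁ (≤-trans (s≤s p) q<s)) (size-≤-sizes q)

  ⟶-decreasing : ∀ {γ γ′} → _⟶_ L γ γ′ → proj₁ γ′ ⊏ proj₁ γ
  ⟶-decreasing (step-skip {q = q})           = replace-head-⊏ skip [] q []
  ⟶-decreasing (step-assign {v = v} {e} {q}) = replace-head-⊏ (v := e) [] q []
  ⟶-decreasing (step-if-true {c = c} {q₁} {q₂} {q} _) =
    replace-head-⊏ (if c then q₁ else q₂) q₁ q
      (sizes-<⇒≺ (if c then q₁ else q₂) q₁ (s≤s (m≤m+n (sizes q₁) (sizes q₂))))
  ⟶-decreasing (step-if-false {c = c} {q₁} {q₂} {q} _) =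
    replace-head-⊏ (if c then q₁ else q₂) q₂ q
      (sizes-<⇒≺ (if c then q₁ else q₂) q₂ (s≤s (m≤n+m (sizes q₂) (sizes q₁))))
  ⟶-decreasing (step-while-true {i = i} {c} {q₁} {q} _) =
    subst (_⊏ (w ∷ q)) (++-assoc q₁ [ w′ ] q)
      (replace-head-⊏ w (q₁ ∷ʳ w′) q
        (∷ʳ⁺ (sizes-<⇒≺ w q₁ (n<1+n (sizes q₁))) (inj₂ (refl , n<1+n i))))
    where w  = while[ i ] c loop q₁
          w′ = while[ suc i ] c loop q₁
  ⟶-decreasing (step-while-false {i = i} {c} {q₁} {q} _) =
    replace-head-⊏ (while[ i ] c loop q₁) [] q []

mainTheorem2 : (L : Lang) (p : Prog L) (n : ℕ) (ex : Execution L p n)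
    (j k : Fin (suc n)) → j ≢ k →
    proj₁ (Execution.conf ex j) ≢ proj₁ (Execution.conf ex k)
mainTheorem2 L p n ex j k j≢k rj≡rk = j≢k (decreasing⇒injective (contOrder L)
  {f = proj₁ ∘ Execution.conf ex} (⟶-decreasing L ∘ Execution.steps ex) (Eq.reflexive rj≡rk))
  where open StrictPartialOrder (contOrder L) using (module Eq)
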